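{- Let $f(x)\in\mathbb{Z}[x]$ have degree at least $3$. For every $n\geq 0$, if $S_n=[1;a_1,\dots,a_m]$, then the partial quotients of $S_{n+1}$ begin with $1,a_1,\dots,a_m$, i.e. $S_{n+1}=[1;a_1,\dots,a_m,b_1,b_2,\dots]$ for some further partial quotients $b_j$.
   Context: For $f(x)\in\mathbb{Z}[x]$ set $f_0(x)=x$ and $f_{n+1}(x)=f(f_n(x))$ for $n\ge 0$. Let $\prod_n=\prod_{i=0}^{n}(1+1/f_i(x))\in\mathbb{Q}(x)$. $S_n$ denotes the continued fraction expansion of $\prod_n$ obtained by applying the Euclidean algorithm in $\mathbb{Q}[x]$ to its numerator and denominator; its partial quotients are polynomials in $\mathbb{Q}[x]$. -}

module Defs where

open import Data.Nat as ℕ using (ℕ; zero; suc; _∸_; _<?_)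
open import Data.Integer using (ℤ)
open import Data.Rational using (ℚ; 0ℚ; 1ℚ; _+_; _*_; -_; _/_; 1/_; ≢-nonZero)
open import Data.Rational.Properties using (_≟_)
open import Data.List using (List; []; _∷_; length; map)
open import Data.Product using (_×_; _,_)
open import Relation.Nullary using (yes; no)

-- Polynomials in ℚ[x]: little-endian coefficient lists, kept normalised
-- (no trailing zero coefficients), so the zero polynomial is [] and
-- propositional equality of normalised lists is equality of polynomials.
Poly : Set
Poly = List ℚ

norm : Poly → Poly
norm [] = []
norm (c ∷ p) with norm p
... | [] with c ≟ 0ℚ
...   | yes _ = []
...   | no _  = c ∷ []
norm (c ∷ p) | d ∷ q = c ∷ d ∷ q

add′ : Poly → Poly → Poly
add′ [] q = q
add′ p [] = p
add′ (a ∷ p) (b ∷ q) = (a + b) ∷ add′ p q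

addP : Poly → Poly → Poly
addP p q = norm (add′ p q)

negP : Poly → Poly
negP p = norm (map -_ p)

subP : Poly → Poly → Poly
subP p q = addP p (negP q)

scaleP : ℚ → Poly → Poly
scaleP c p = norm (map (c *_) p)

xTimes : Poly → Poly
xTimes [] = []
xTimes (c ∷ p) = 0ℚ ∷ c ∷ p

mulP : Poly → Poly → Poly
mulP [] q = []
mulP (c ∷ p) q = addP (scaleP c q) (xTimes (mulP p q))

constP : ℚ → Poly
constP c = norm (c ∷ [])

oneP : Poly
oneP = constP 1ℚ

X : Poly
X = 0ℚ ∷ 1ℚ ∷ []

compP : Poly → Poly → Poly
compP [] g = []
compP (c ∷ p) g = addP (constP c) (mulP g (compP p g))

-- degree of a (normalised) nonzero polynomial; deg 0 = 0 by convention
deg : Poly → ℕ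
deg p = length p ∸ 1

lc : Poly → ℚ
lc [] = 0ℚ
lc (c ∷ []) = c
lc (c ∷ d ∷ p) = lc (d ∷ p)

-- inverse of a rational (only used on nonzero arguments)
inv : ℚ → ℚ
inv c with c ≟ 0ℚ
... | yes _ = 0ℚ
... | no c≢0 = 1/_ c {{≢-nonZero c≢0}}

monomial : ℚ → ℕ → Poly
monomial c zero = constP c
monomial c (suc k) = xTimes (monomial c k)

divStep : ℕ → Poly → Poly → Poly × Poly
divStep zero a b = [] , a
divStep (suc k) a b with length a <? length b
... | yes _ = [] , a
... | no _ with divStep k (subP a (mulP (monomial (lc a * inv (lc b)) (length a ∸ length b)) b)) b
...   | q , r = addP (monomial (lc a * inv (lc b)) (length a ∸ length b)) q , r

-- Euclidean division in ℚ[x] (for b ≠ 0); the fuel length a + 1 suffices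
-- since each step strictly lowers the length of the dividend.
divModP : Poly → Poly → Poly × Poly
divModP a b = divStep (suc (length a)) a b

cfStep : ℕ → Poly → Poly → List Poly
cfStep zero a b = []
cfStep (suc k) a [] = []
cfStep (suc k) a (c ∷ b) with divModP a (c ∷ b)
... | q , r = q ∷ cfStep k (c ∷ b) r

-- continued fraction expansion of a/b; fuel suffices since the length of
-- the second argument strictly decreases at each step
cf : Poly → Poly → List Poly
cf a b = cfStep (suc (length a ℕ.+ length b)) a b

ofℤ : List ℤ → Poly
ofℤ f = norm (map (λ z → z / 1) f)

iter : Poly → ℕ → Poly
iter F zero = X
iter F (suc i) = compP F (iter F i)

-- Π_n = ∏_{i=0}^n (1 + 1/f_i) = (∏ (f_i + 1)) / (∏ f_i)
numΠ : Poly → ℕ → Poly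
numΠ F zero = addP (iter F zero) oneP
numΠ F (suc n) = mulP (numΠ F n) (addP (iter F (suc n)) oneP)

denΠ : Poly → ℕ → Poly
denΠ F zero = iter F zero
denΠ F (suc n) = mulP (denΠ F n) (iter F (suc n))

S : List ℤ → ℕ → List Poly
S f n = cf (numΠ (ofℤ f) n) (denΠ (ofℤ f) n)

-- Write Π_n = a/b and g = f_(n+1), so that Π_(n+1) = a(g + 1)/(bg) has numerator
-- a·g + 1·a and denominator b·g + 0·a. With d = deg f ≥ 3, deg g = d^(n+1) exceeds
-- 2(1 + d + ⋯ + d^n) ≥ deg a + deg b, so g dominates the cofactors of a: if
-- P = ρg + μa and Q = σg + νa with deg ν + deg ρ and deg μ + deg σ at most
-- 1 + d + ⋯ + d^n, then dividing P by Q gives the same quotient q as dividing ρ by σ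
-- (by uniqueness of the quotient), and the remainder is τg + (μ − qν)a, where τ is
-- the remainder of ρ by σ, so that (Q, τg + (μ − qν)a) has the same shape with respect
-- to (σ, τ). Hence Euclid's algorithm on (ag + a, bg) reproduces its run on (a, b)
-- until the latter stops.
-- Polynomials are compared through their coefficient series, which form a commutative
-- ring under the Cauchy product, so the ring identities are left to the ring solver.
module Submission where

open import Defs
open import Data.Nat using (ℕ; suc; _≤_)
open import Data.Integer using (ℤ)
open import Data.List using (List; _∷_; _++_)
open import Data.Product using (∃)
open import Relation.Binary.PropositionalEquality using (_≡_)

open import Algebra.Bundles using (CommutativeRing)
import Algebra.Solver.Ring.AlmostCommutativeRing as ACR
open import Algebra.Structures using (IsCommutativeRing)
open import Data.Empty using (⊥-elim)
open import Data.List using ([]; length; map)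
open import Data.Maybe using (just; nothing)
open import Data.Nat as ℕ using (zero; _<_; _∸_; _^_; z≤n; s≤s)
import Data.Nat.Properties as ℕₚ
import Data.Nat.Tactic.RingSolver as ℕ-Solver
open import Data.Product using (_×_; _,_; proj₁; proj₂)
open import Data.Rational as ℚ using (ℚ; 0ℚ; 1ℚ; _+_; _*_; -_)
import Data.Rational.Properties as ℚₚ
open import Data.Sum using (_⊎_; inj₁; inj₂)
open import Relation.Binary using (IsEquivalence)
open import Relation.Binary.Definitions using (WeaklyDecidable)
open import Relation.Binary.PropositionalEquality
  using (_≢_; refl; sym; trans; cong; cong₂; subst; module ≡-Reasoning)
import Relation.Binary.Reasoning.Setoid as SetoidReasoning
open import Relation.Nullary using (yes; no)
open import Tactic.RingSolver using (solve-∀)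
open import Tactic.RingSolver.Core.AlmostCommutativeRing
  using (AlmostCommutativeRing; fromCommutativeRing)
open import Algebra.Apartness.Properties.HeytingCommutativeRing ℚₚ.heytingCommutativeRing
  using (x#0y#0→xy#0)
open import Algebra.Properties.Group ℚₚ.+-0-group using (x∙y⁻¹≈ε⇒x≈y)

-- Power series over ℚ

ℚ-ring : AlmostCommutativeRing _ _
ℚ-ring = fromCommutativeRing ℚₚ.+-*-commutativeRing (λ _ → nothing)

Series : Set
Series = ℕ → ℚ

infix  4 _≐_ _≋_
infixl 6 _⊕_
infixl 7 _⊛_ _·_
infix  8 ⊝_

_≐_ : Series → Series → Set
f ≐ g = ∀ i → f i ≡ g i

-- Wrapping _≐_ in a record makes both sides inferable from an equation.
record _≋_ (f g : Series) : Set where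
  constructor mk≋
  field coeffwise : f ≐ g
open _≋_ public

0ₛ : Series
0ₛ _ = 0ℚ

constₛ : ℚ → Series
constₛ c zero = c
constₛ c (suc _) = 0ℚ

1ₛ : Series
1ₛ = constₛ 1ℚ

_⊕_ : Series → Series → Series
(f ⊕ g) i = f i + g i

⊝_ : Series → Series
(⊝ f) i = - f i

_·_ : ℚ → Series → Series
(c · f) i = c * f i

tail : Series → Series
tail f i = f (suc i)

timesX : Series → Series
timesX f zero = 0ℚ
timesX f (suc i) = f i

_⊛_ : Series → Series → Series
(f ⊛ g) zero = f 0 * g 0
(f ⊛ g) (suc i) = f 0 * g (suc i) + (tail f ⊛ g) i

⊛-cong : ∀ {f f′ g g′} → f ≐ f′ → g ≐ g′ → f ⊛ g ≐ f′ ⊛ g′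
⊛-cong f≐f′ g≐g′ zero = cong₂ _*_ (f≐f′ 0) (g≐g′ 0)
⊛-cong f≐f′ g≐g′ (suc i) =
  cong₂ _+_ (cong₂ _*_ (f≐f′ 0) (g≐g′ (suc i))) (⊛-cong (λ j → f≐f′ (suc j)) g≐g′ i)

⊛-zeroˡ : ∀ f → 0ₛ ⊛ f ≐ 0ₛ
⊛-zeroˡ f zero = ℚₚ.*-zeroˡ (f 0)
⊛-zeroˡ f (suc i) = trans (cong₂ _+_ (ℚₚ.*-zeroˡ (f (suc i))) (⊛-zeroˡ f i)) (ℚₚ.+-identityʳ 0ℚ)

constₛ-⊛ : ∀ c f → constₛ c ⊛ f ≐ c · f
constₛ-⊛ c f zero = refl
constₛ-⊛ c f (suc i) = trans (cong (c * f (suc i) +_) (⊛-zeroˡ f i)) (ℚₚ.+-identityʳ _)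

timesX-⊛ : ∀ f g i → (timesX f ⊛ g) (suc i) ≡ (f ⊛ g) i
timesX-⊛ f g i = trans (cong (_+ (f ⊛ g) i) (ℚₚ.*-zeroˡ (g (suc i)))) (ℚₚ.+-identityˡ _)

⊛-unfoldʳ : ∀ f g i → (f ⊛ g) (suc i) ≡ (f ⊛ tail g) i + f (suc i) * g 0
⊛-unfoldʳ f g zero = refl
⊛-unfoldʳ f g (suc i) = begin
    f 0 * g (suc (suc i)) + (tail f ⊛ g) (suc i)
  ≡⟨ cong (f 0 * g (suc (suc i)) +_) (⊛-unfoldʳ (tail f) g i) ⟩
    f 0 * g (suc (suc i)) + ((tail f ⊛ tail g) i + f (suc (suc i)) * g 0)
  ≡⟨ ℚₚ.+-assoc (f 0 * g (suc (suc i))) ((tail f ⊛ tail g) i) (f (suc (suc i)) * g 0) ⟨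
    f 0 * g (suc (suc i)) + (tail f ⊛ tail g) i + f (suc (suc i)) * g 0 ∎
  where open ≡-Reasoning

⊛-comm : ∀ f g → f ⊛ g ≐ g ⊛ f
⊛-comm f g zero = ℚₚ.*-comm (f 0) (g 0)
⊛-comm f g (suc i) = begin
    f 0 * g (suc i) + (tail f ⊛ g) i
  ≡⟨ cong₂ _+_ (ℚₚ.*-comm (f 0) (g (suc i))) (⊛-comm (tail f) g i) ⟩
    g (suc i) * f 0 + (g ⊛ tail f) i
  ≡⟨ ℚₚ.+-comm (g (suc i) * f 0) _ ⟩
    (g ⊛ tail f) i + g (suc i) * f 0
  ≡⟨ ⊛-unfoldʳ g f i ⟨
    (g ⊛ f) (suc i) ∎
  where open ≡-Reasoning

⊛-distribˡ : ∀ f g h → f ⊛ (g ⊕ h) ≐ f ⊛ g ⊕ f ⊛ h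
⊛-distribˡ f g h zero = ℚₚ.*-distribˡ-+ (f 0) (g 0) (h 0)
⊛-distribˡ f g h (suc i) = begin
    f 0 * (g (suc i) + h (suc i)) + (tail f ⊛ (g ⊕ h)) i
  ≡⟨ cong (f 0 * (g (suc i) + h (suc i)) +_) (⊛-distribˡ (tail f) g h i) ⟩
    f 0 * (g (suc i) + h (suc i)) + ((tail f ⊛ g) i + (tail f ⊛ h) i)
  ≡⟨ regroup (f 0) (g (suc i)) (h (suc i)) _ _ ⟩
    (f 0 * g (suc i) + (tail f ⊛ g) i) + (f 0 * h (suc i) + (tail f ⊛ h) i) ∎
  where
  open ≡-Reasoning
  regroup : ∀ a b c d e → a * (b + c) + (d + e) ≡ (a * b + d) + (a * c + e)
  regroup = solve-∀ ℚ-ring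

⊛-distribʳ : ∀ f g h → (g ⊕ h) ⊛ f ≐ g ⊛ f ⊕ h ⊛ f
⊛-distribʳ f g h i =
  trans (⊛-comm (g ⊕ h) f i)
        (trans (⊛-distribˡ f g h i) (cong₂ _+_ (⊛-comm f g i) (⊛-comm f h i)))

·-⊛ : ∀ c f g → (c · f) ⊛ g ≐ c · (f ⊛ g)
·-⊛ c f g zero = ℚₚ.*-assoc c (f 0) (g 0)
·-⊛ c f g (suc i) = begin
    c * f 0 * g (suc i) + (tail (c · f) ⊛ g) i
  ≡⟨ cong (c * f 0 * g (suc i) +_) (·-⊛ c (tail f) g i) ⟩
    c * f 0 * g (suc i) + c * (tail f ⊛ g) i
  ≡⟨ factor c (f 0) (g (suc i)) _ ⟩
    c * (f 0 * g (suc i) + (tail f ⊛ g) i) ∎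
  where
  open ≡-Reasoning
  factor : ∀ a b c d → a * b * c + a * d ≡ a * (b * c + d)
  factor = solve-∀ ℚ-ring

⊛-assoc : ∀ f g h → (f ⊛ g) ⊛ h ≐ f ⊛ (g ⊛ h)
⊛-assoc f g h zero = ℚₚ.*-assoc (f 0) (g 0) (h 0)
⊛-assoc f g h (suc i) = begin
    f 0 * g 0 * h (suc i) + (tail (f ⊛ g) ⊛ h) i
  ≡⟨ cong (f 0 * g 0 * h (suc i) +_) (⊛-distribʳ h (f 0 · tail g) (tail f ⊛ g) i) ⟩
    f 0 * g 0 * h (suc i) + (((f 0 · tail g) ⊛ h) i + ((tail f ⊛ g) ⊛ h) i)
  ≡⟨ cong₂ (λ x y → f 0 * g 0 * h (suc i) + (x + y)) (·-⊛ (f 0) (tail g) h i) (⊛-assoc (tail f) g h i) ⟩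
    f 0 * g 0 * h (suc i) + (f 0 * (tail g ⊛ h) i + (tail f ⊛ (g ⊛ h)) i)
  ≡⟨ regroup (f 0) (g 0) (h (suc i)) _ _ ⟩
    f 0 * (g 0 * h (suc i) + (tail g ⊛ h) i) + (tail f ⊛ (g ⊛ h)) i ∎
  where
  open ≡-Reasoning
  regroup : ∀ a b c d e → a * b * c + (a * d + e) ≡ a * (b * c + d) + e
  regroup = solve-∀ ℚ-ring

⊛-identityˡ : ∀ f → 1ₛ ⊛ f ≐ f
⊛-identityˡ f i = trans (constₛ-⊛ 1ℚ f i) (ℚₚ.*-identityˡ (f i))

≋-isEquivalence : IsEquivalence _≋_
≋-isEquivalence = record
  { refl  = mk≋ λ _ → refl
  ; sym   = λ f≋g → mk≋ λ i → sym (coeffwise f≋g i)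
  ; trans = λ f≋g g≋h → mk≋ λ i → trans (coeffwise f≋g i) (coeffwise g≋h i)
  }

⊛-isCommutativeRing : IsCommutativeRing _≋_ _⊕_ _⊛_ ⊝_ 0ₛ 1ₛ
⊛-isCommutativeRing = record
  { isRing = record
    { +-isAbelianGroup = record
      { isGroup = record
        { isMonoid = record
          { isSemigroup = record
            { isMagma = record
              { isEquivalence = ≋-isEquivalence
              ; ∙-cong = λ e e′ → mk≋ λ i → cong₂ _+_ (coeffwise e i) (coeffwise e′ i) }
            ; assoc = λ f g h → mk≋ λ i → ℚₚ.+-assoc (f i) (g i) (h i) }
          ; identity = (λ f → mk≋ λ i → ℚₚ.+-identityˡ (f i)) , (λ f → mk≋ λ i → ℚₚ.+-identityʳ (f i)) }
        ; inverse = (λ f → mk≋ λ i → ℚₚ.+-inverseˡ (f i)) , (λ f → mk≋ λ i → ℚₚ.+-inverseʳ (f i))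
        ; ⁻¹-cong = λ e → mk≋ λ i → cong -_ (coeffwise e i) }
      ; comm = λ f g → mk≋ λ i → ℚₚ.+-comm (f i) (g i) }
    ; *-cong = λ e e′ → mk≋ (⊛-cong (coeffwise e) (coeffwise e′))
    ; *-assoc = λ f g h → mk≋ (⊛-assoc f g h)
    ; *-identity = (λ f → mk≋ (⊛-identityˡ f))
                 , (λ f → mk≋ λ i → trans (⊛-comm f 1ₛ i) (⊛-identityˡ f i))
    ; distrib = (λ f g h → mk≋ (⊛-distribˡ f g h)) , (λ f g h → mk≋ (⊛-distribʳ f g h)) }
  ; *-comm = λ f g → mk≋ (⊛-comm f g) }

⊛-commutativeRing : CommutativeRing _ _
⊛-commutativeRing = record { isCommutativeRing = ⊛-isCommutativeRing }

module Ser = CommutativeRing ⊛-commutativeRing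

-- The solver over series takes its coefficients from ℚ, as constant series.
Series-ring : ACR.AlmostCommutativeRing _ _
Series-ring = ACR.fromCommutativeRing ⊛-commutativeRing

constₛ-morphism : ℚₚ.+-*-rawRing ACR.-Raw-AlmostCommutative⟶ Series-ring
constₛ-morphism = record
  { ⟦_⟧    = constₛ
  ; +-homo = λ c d → mk≋ λ { zero → refl ; (suc i) → sym (ℚₚ.+-identityʳ 0ℚ) }
  ; *-homo = λ c d → mk≋ λ i → sym (trans (constₛ-⊛ c (constₛ d) i) (constₛ-scale {c} {d} i))
  ; -‿homo = λ c → mk≋ λ { zero → refl ; (suc i) → refl }
  ; 0-homo = mk≋ λ { zero → refl ; (suc i) → refl }
  ; 1-homo = mk≋ λ { zero → refl ; (suc i) → refl }
  }
  where
  constₛ-scale : ∀ {c d} → c · constₛ d ≐ constₛ (c * d)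
  constₛ-scale zero = refl
  constₛ-scale {c} (suc i) = ℚₚ.*-zeroʳ c

constₛ-≟ : WeaklyDecidable (ACR.Induced-equivalence constₛ-morphism)
constₛ-≟ c d with c ℚₚ.≟ d
... | yes refl = just (mk≋ λ _ → refl)
... | no _ = nothing

open import Algebra.Solver.Ring ℚₚ.+-*-rawRing Series-ring constₛ-morphism constₛ-≟
  using (solve; _:=_; _:+_; _:*_; _:-_)

-- Coefficient series of polynomials

coeff : Poly → Series
coeff [] _ = 0ℚ
coeff (c ∷ p) zero = c
coeff (c ∷ p) (suc i) = coeff p i

Normal : Poly → Set
Normal p = norm p ≡ p

coeff-norm : ∀ p → coeff (norm p) ≐ coeff p
coeff-norm [] i = refl
coeff-norm (c ∷ p) i with norm p | coeff-norm p
... | [] | ih with c ℚₚ.≟ 0ℚ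
...   | yes c≡0 = dropped i
  where
  dropped : ∀ i → 0ℚ ≡ coeff (c ∷ p) i
  dropped zero = sym c≡0
  dropped (suc i) = ih i
...   | no _ = kept i
  where
  kept : ∀ i → coeff (c ∷ []) i ≡ coeff (c ∷ p) i
  kept zero = refl
  kept (suc i) = ih i
coeff-norm (c ∷ p) zero | d ∷ q | ih = refl
coeff-norm (c ∷ p) (suc i) | d ∷ q | ih = ih i

norm-cong-≐ : ∀ p q → coeff p ≐ coeff q → norm p ≡ norm q
norm-cong-≐ [] [] p≐q = refl
norm-cong-≐ [] (d ∷ q) p≐q with norm q | norm-cong-≐ [] q (λ i → p≐q (suc i))
... | .[] | refl with d ℚₚ.≟ 0ℚ
...   | yes _ = refl
...   | no d≢0 = ⊥-elim (d≢0 (sym (p≐q 0)))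
norm-cong-≐ (c ∷ p) [] p≐q with norm p | norm-cong-≐ p [] (λ i → p≐q (suc i))
... | .[] | refl with c ℚₚ.≟ 0ℚ
...   | yes _ = refl
...   | no c≢0 = ⊥-elim (c≢0 (p≐q 0))
norm-cong-≐ (c ∷ p) (d ∷ q) p≐q with p≐q 0
... | refl rewrite norm-cong-≐ p q (λ i → p≐q (suc i)) = refl

coeff-injective : ∀ {p q} → Normal p → Normal q → coeff p ≐ coeff q → p ≡ q
coeff-injective {p} {q} np nq p≐q = trans (sym np) (trans (norm-cong-≐ p q p≐q) nq)

norm-Normal : ∀ p → Normal (norm p)
norm-Normal p = norm-cong-≐ (norm p) p (coeff-norm p)

Normal-tail : ∀ c d p → Normal (c ∷ d ∷ p) → Normal (d ∷ p)
Normal-tail c d p np with norm (d ∷ p) in eq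
Normal-tail c d p np | [] with c ℚₚ.≟ 0ℚ
Normal-tail c d p () | [] | yes _
Normal-tail c d p () | [] | no _
Normal-tail c d p refl | e ∷ q = refl

Normal⇒lc≢0 : ∀ c p → Normal (c ∷ p) → lc (c ∷ p) ≢ 0ℚ
Normal⇒lc≢0 c [] np with c ℚₚ.≟ 0ℚ
Normal⇒lc≢0 c [] () | yes _
... | no c≢0 = c≢0
Normal⇒lc≢0 c (d ∷ p) np = Normal⇒lc≢0 d p (Normal-tail c d p np)

lc≡coeff-length : ∀ c p → lc (c ∷ p) ≡ coeff (c ∷ p) (length p)
lc≡coeff-length c [] = refl
lc≡coeff-length c (d ∷ p) = lc≡coeff-length d p

addP-Normal : ∀ p q → Normal (addP p q)
addP-Normal p q = norm-Normal (add′ p q)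

subP-Normal : ∀ p q → Normal (subP p q)
subP-Normal p q = norm-Normal (add′ p (negP q))

mulP-Normal : ∀ p q → Normal (mulP p q)
mulP-Normal [] q = refl
mulP-Normal (c ∷ p) q = norm-Normal (add′ (scaleP c q) (xTimes (mulP p q)))

coeff-addP : ∀ p q → coeff (addP p q) ≐ coeff p ⊕ coeff q
coeff-addP p q i = trans (coeff-norm (add′ p q) i) (coeff-add′ p q i)
  where
  coeff-add′ : ∀ p q → coeff (add′ p q) ≐ coeff p ⊕ coeff q
  coeff-add′ [] q i = sym (ℚₚ.+-identityˡ (coeff q i))
  coeff-add′ (c ∷ p) [] i = sym (ℚₚ.+-identityʳ (coeff (c ∷ p) i))
  coeff-add′ (c ∷ p) (d ∷ q) zero = refl
  coeff-add′ (c ∷ p) (d ∷ q) (suc i) = coeff-add′ p q i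

coeff-map : ∀ (φ : ℚ → ℚ) → φ 0ℚ ≡ 0ℚ → ∀ p → coeff (map φ p) ≐ λ i → φ (coeff p i)
coeff-map φ φ0 [] i = sym φ0
coeff-map φ φ0 (c ∷ p) zero = refl
coeff-map φ φ0 (c ∷ p) (suc i) = coeff-map φ φ0 p i

coeff-subP : ∀ p q → coeff (subP p q) ≐ coeff p ⊕ ⊝ coeff q
coeff-subP p q i = begin
    coeff (addP p (negP q)) i        ≡⟨ coeff-addP p (negP q) i ⟩
    coeff p i + coeff (negP q) i     ≡⟨ cong (coeff p i +_) (coeff-norm (map -_ q) i) ⟩
    coeff p i + coeff (map -_ q) i   ≡⟨ cong (coeff p i +_) (coeff-map -_ refl q i) ⟩
    coeff p i + - coeff q i          ∎
  where open ≡-Reasoning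

coeff-scaleP : ∀ c p → coeff (scaleP c p) ≐ c · coeff p
coeff-scaleP c p i = trans (coeff-norm (map (c *_) p) i) (coeff-map (c *_) (ℚₚ.*-zeroʳ c) p i)

coeff-xTimes : ∀ p → coeff (xTimes p) ≐ timesX (coeff p)
coeff-xTimes [] zero = refl
coeff-xTimes [] (suc i) = refl
coeff-xTimes (c ∷ p) zero = refl
coeff-xTimes (c ∷ p) (suc i) = refl

coeff-mulP : ∀ p q → coeff (mulP p q) ≐ coeff p ⊛ coeff q
coeff-mulP [] q i = sym (⊛-zeroˡ (coeff q) i)
coeff-mulP (c ∷ p) q zero = begin
    coeff (addP (scaleP c q) (xTimes (mulP p q))) 0
      ≡⟨ coeff-addP (scaleP c q) (xTimes (mulP p q)) 0 ⟩
    coeff (scaleP c q) 0 + coeff (xTimes (mulP p q)) 0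
      ≡⟨ cong₂ _+_ (coeff-scaleP c q 0) (coeff-xTimes (mulP p q) 0) ⟩
    c * coeff q 0 + 0ℚ
      ≡⟨ ℚₚ.+-identityʳ _ ⟩
    c * coeff q 0 ∎
  where open ≡-Reasoning
coeff-mulP (c ∷ p) q (suc i) =
  trans (coeff-addP (scaleP c q) (xTimes (mulP p q)) (suc i))
        (cong₂ _+_ (coeff-scaleP c q (suc i))
                   (trans (coeff-xTimes (mulP p q) (suc i)) (coeff-mulP p q i)))

coeff-subP-mulP : ∀ μ q ν → coeff (subP μ (mulP q ν)) ≐ coeff μ ⊕ ⊝ (coeff q ⊛ coeff ν)
coeff-subP-mulP μ q ν i =
  trans (coeff-subP μ (mulP q ν) i) (cong (λ t → coeff μ i + - t) (coeff-mulP q ν i))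

coeff-constP : ∀ c → coeff (constP c) ≐ constₛ c
coeff-constP c i = trans (coeff-norm (c ∷ []) i) (singleton i)
  where
  singleton : coeff (c ∷ []) ≐ constₛ c
  singleton zero = refl
  singleton (suc i) = refl

-- Degree bounds

DegLt : Series → ℕ → Set
DegLt f n = ∀ j → n ≤ j → f j ≡ 0ℚ

HasDeg : Series → ℕ → Set
HasDeg f k = f k ≢ 0ℚ × DegLt f (suc k)

DegLt-mono : ∀ {f m n} → m ≤ n → DegLt f m → DegLt f n
DegLt-mono m≤n f<m j n≤j = f<m j (ℕₚ.≤-trans m≤n n≤j)

DegLt-cong : ∀ {f g n} → f ≐ g → DegLt f n → DegLt g n
DegLt-cong f≐g f<n j n≤j = trans (sym (f≐g j)) (f<n j n≤j)

DegLt-⊕ : ∀ {f g n} → DegLt f n → DegLt g n → DegLt (f ⊕ g) n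
DegLt-⊕ f<n g<n j n≤j = trans (cong₂ _+_ (f<n j n≤j) (g<n j n≤j)) (ℚₚ.+-identityʳ 0ℚ)

DegLt-⊝ : ∀ {f n} → DegLt f n → DegLt (⊝ f) n
DegLt-⊝ f<n j n≤j = cong -_ (f<n j n≤j)

DegLt-constₛ : ∀ c → DegLt (constₛ c) 1
DegLt-constₛ c (suc j) _ = refl

DegLt-length : ∀ p → DegLt (coeff p) (length p)
DegLt-length [] j _ = refl
DegLt-length (c ∷ p) (suc j) (s≤s p≤j) = DegLt-length p j p≤j

DegLt-deg : ∀ p → DegLt (coeff p) (suc (deg p))
DegLt-deg [] j _ = refl
DegLt-deg (c ∷ p) = DegLt-length (c ∷ p)

length-least : ∀ {n} p → Normal p → DegLt (coeff p) n → length p ≤ n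
length-least [] np p<n = z≤n
length-least {n} (c ∷ p) np p<n with suc (length p) ℕₚ.≤? n
... | yes p≤n = p≤n
... | no p≰n = ⊥-elim (Normal⇒lc≢0 c p np
      (trans (lc≡coeff-length c p) (p<n (length p) (ℕₚ.≤-pred (ℕₚ.≰⇒> p≰n)))))

deg-least : ∀ {n} p → Normal p → DegLt (coeff p) (suc n) → deg p ≤ n
deg-least p np p<n = ℕₚ.∸-monoˡ-≤ 1 (length-least p np p<n)

HasDeg-cong : ∀ {f g k} → f ≐ g → HasDeg f k → HasDeg g k
HasDeg-cong f≐g (fk≢0 , f<k) = (λ gk≡0 → fk≢0 (trans (f≐g _) gk≡0)) , DegLt-cong f≐g f<k

HasDeg-cons : ∀ c p → Normal (c ∷ p) → HasDeg (coeff (c ∷ p)) (length p)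
HasDeg-cons c p np =
  (λ top≡0 → Normal⇒lc≢0 c p np (trans (lc≡coeff-length c p) top≡0)) , DegLt-length (c ∷ p)

HasDeg⇒deg : ∀ {k} p → Normal p → HasDeg (coeff p) k → p ≢ [] × deg p ≡ k
HasDeg⇒deg [] np (top≢0 , _) = ⊥-elim (top≢0 refl)
HasDeg⇒deg {k} (c ∷ p) np (top≢0 , p<k) =
  (λ ()) , ℕₚ.≤-antisym (ℕₚ.≤-pred (length-least (c ∷ p) np p<k)) k≤p
  where
  k≤p : k ≤ length p
  k≤p with k ℕₚ.≤? length p
  ... | yes k≤p = k≤p
  ... | no k≰p = ⊥-elim (top≢0 (DegLt-length (c ∷ p) k (ℕₚ.≰⇒> k≰p)))

HasDeg-⊕-DegLt : ∀ {f g k} → HasDeg f k → DegLt g k → HasDeg (f ⊕ g) k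
HasDeg-⊕-DegLt {f} {g} {k} (fk≢0 , f<k) g<k =
  (λ fgk≡0 → fk≢0 (begin
      f k            ≡⟨ ℚₚ.+-identityʳ (f k) ⟨
      f k + 0ℚ       ≡⟨ cong (f k +_) (g<k k ℕₚ.≤-refl) ⟨
      f k + g k      ≡⟨ fgk≡0 ⟩
      0ℚ             ∎)) ,
  DegLt-⊕ f<k (DegLt-mono (ℕₚ.n≤1+n k) g<k)
  where open ≡-Reasoning

⊛-DegLt-zero : ∀ {f} g → DegLt f 0 → f ⊛ g ≐ 0ₛ
⊛-DegLt-zero g f<0 i = trans (⊛-cong (λ j → f<0 j z≤n) (λ _ → refl) i) (⊛-zeroˡ g i)

DegLt-⊛ : ∀ m {n f g} → DegLt f m → DegLt g (suc n) → DegLt (f ⊛ g) (m ℕ.+ n)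
DegLt-⊛ zero {f = f} {g} f<0 g<n j _ = ⊛-DegLt-zero g f<0 j
DegLt-⊛ (suc m) {n} {f} {g} f<m g<n (suc j) (s≤s m+n≤j) =
  trans (cong₂ _+_ (trans (cong (f 0 *_) (g<n (suc j) (s≤s (ℕₚ.≤-trans (ℕₚ.m≤n+m n m) m+n≤j))))
                          (ℚₚ.*-zeroʳ (f 0)))
                   (DegLt-⊛ m {n} {tail f} {g} (λ i m≤i → f<m (suc i) (s≤s m≤i)) g<n j m+n≤j))
        (ℚₚ.+-identityʳ 0ℚ)

⊛-top : ∀ m {n f g} → DegLt f (suc m) → DegLt g (suc n) → (f ⊛ g) (m ℕ.+ n) ≡ f m * g n
⊛-top zero {zero} f<1 g<n = refl
⊛-top zero {suc n} {f} {g} f<1 g<n =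
  trans (cong (f 0 * g (suc n) +_) (⊛-DegLt-zero g (λ j _ → f<1 (suc j) (s≤s z≤n)) n))
        (ℚₚ.+-identityʳ _)
⊛-top (suc m) {n} {f} {g} f<m g<n =
  trans (cong₂ _+_ (trans (cong (f 0 *_) (g<n (suc (m ℕ.+ n)) (s≤s (ℕₚ.m≤n+m n m)))) (ℚₚ.*-zeroʳ (f 0)))
                   (⊛-top m {n} {tail f} {g} (λ i m≤i → f<m (suc i) (s≤s m≤i)) g<n))
        (ℚₚ.+-identityˡ _)

HasDeg-⊛ : ∀ {f g m n} → HasDeg f m → HasDeg g n → HasDeg (f ⊛ g) (m ℕ.+ n)
HasDeg-⊛ {f} {g} {m} {n} (fm≢0 , f<m) (gn≢0 , g<n) =
  (λ top≡0 → x#0y#0→xy#0 fm≢0 gn≢0 (trans (sym (⊛-top m f<m g<n)) top≡0)) ,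
  DegLt-⊛ (suc m) f<m g<n

-- Euclidean division

inv-inverseˡ : ∀ c → c ≢ 0ℚ → inv c * c ≡ 1ℚ
inv-inverseˡ c c≢0 with c ℚₚ.≟ 0ℚ
... | yes c≡0 = ⊥-elim (c≢0 c≡0)
... | no c≢0 = ℚₚ.*-inverseˡ c {{ℚ.≢-nonZero c≢0}}

monomial-⊛ : ∀ c e g j → (coeff (monomial c e) ⊛ g) (e ℕ.+ j) ≡ c * g j
monomial-⊛ c zero g j = trans (⊛-cong (coeff-constP c) (λ _ → refl) j) (constₛ-⊛ c g j)
monomial-⊛ c (suc e) g j = begin
    (coeff (xTimes (monomial c e)) ⊛ g) (suc (e ℕ.+ j))
  ≡⟨ ⊛-cong (coeff-xTimes (monomial c e)) (λ _ → refl) (suc (e ℕ.+ j)) ⟩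
    (timesX (coeff (monomial c e)) ⊛ g) (suc (e ℕ.+ j))
  ≡⟨ timesX-⊛ (coeff (monomial c e)) g (e ℕ.+ j) ⟩
    (coeff (monomial c e) ⊛ g) (e ℕ.+ j)
  ≡⟨ monomial-⊛ c e g j ⟩
    c * g j ∎
  where open ≡-Reasoning

leadMonomial : Poly → Poly → Poly
leadMonomial a b = monomial (lc a * inv (lc b)) (length a ∸ length b)

reduce : Poly → Poly → Poly
reduce a b = subP a (mulP (leadMonomial a b) b)

x-[x*inv[y]]*y≡0 : ∀ x y → y ≢ 0ℚ → x + - (x * inv y * y) ≡ 0ℚ
x-[x*inv[y]]*y≡0 x y y≢0 = begin
  x + - (x * inv y * y)     ≡⟨ cong (λ t → x + - t) (ℚₚ.*-assoc x (inv y) y) ⟩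
  x + - (x * (inv y * y))   ≡⟨ cong (λ t → x + - (x * t)) (inv-inverseˡ y y≢0) ⟩
  x + - (x * 1ℚ)            ≡⟨ cong (λ t → x + - t) (ℚₚ.*-identityʳ x) ⟩
  x + - x                   ≡⟨ ℚₚ.+-inverseʳ x ⟩
  0ℚ                        ∎
  where open ≡-Reasoning

reduce-Normal : ∀ a b → Normal (reduce a b)
reduce-Normal a b = subP-Normal a (mulP (leadMonomial a b) b)

reduce-length : ∀ x as y bs → Normal (y ∷ bs) → length bs ≤ length as →
  length (reduce (x ∷ as) (y ∷ bs)) ≤ length as
reduce-length x as y bs nB bs≤as = length-least (reduce A B) (reduce-Normal A B) vanishes
  where
  open ≡-Reasoning
  A = x ∷ as
  B = y ∷ bs
  e = length as ∸ length bs
  c = lc A * inv (lc B)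
  e≤as : e ≤ length as
  e≤as = ℕₚ.m∸n≤m (length as) (length bs)
  coeff-reduce : ∀ {j} → length as ≤ j → coeff (reduce A B) j ≡ coeff A j + - (c * coeff B (j ∸ e))
  coeff-reduce {j} as≤j = begin
      coeff (reduce A B) j
    ≡⟨ coeff-subP-mulP A m B j ⟩
      coeff A j + - (coeff m ⊛ coeff B) j
    ≡⟨ cong (λ i → coeff A j + - (coeff m ⊛ coeff B) i) (ℕₚ.m+[n∸m]≡n (ℕₚ.≤-trans e≤as as≤j)) ⟨
      coeff A j + - (coeff m ⊛ coeff B) (e ℕ.+ (j ∸ e))
    ≡⟨ cong (λ t → coeff A j + - t) (monomial-⊛ c e (coeff B) (j ∸ e)) ⟩
      coeff A j + - (c * coeff B (j ∸ e)) ∎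
    where m = leadMonomial A B
  vanishes : DegLt (coeff (reduce A B)) (length as)
  vanishes j as≤j with ℕₚ.m≤n⇒m<n∨m≡n as≤j
  ... | inj₂ refl = begin
      coeff (reduce A B) (length as)
    ≡⟨ coeff-reduce as≤j ⟩
      coeff A (length as) + - (c * coeff B (length as ∸ e))
    ≡⟨ cong₂ (λ s t → s + - (c * t)) (lc≡coeff-length x as)
             (trans (lc≡coeff-length y bs) (cong (coeff B) (sym (ℕₚ.m∸[m∸n]≡n bs≤as)))) ⟨
      lc A + - (c * lc B)
    ≡⟨ x-[x*inv[y]]*y≡0 (lc A) (lc B) (Normal⇒lc≢0 y bs nB) ⟩
      0ℚ ∎
  ... | inj₁ as<j = begin
      coeff (reduce A B) j
    ≡⟨ coeff-reduce as≤j ⟩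
      coeff A j + - (c * coeff B (j ∸ e))
    ≡⟨ cong₂ (λ s t → s + - (c * t)) (DegLt-length A j as<j) (DegLt-length B (j ∸ e) B≤j∸e) ⟩
      0ℚ + - (c * 0ℚ)
    ≡⟨ cong (λ t → 0ℚ + - t) (ℚₚ.*-zeroʳ c) ⟩
      0ℚ ∎
    where
    B≤j∸e : length B ≤ j ∸ e
    B≤j∸e = subst (_< j ∸ e) (ℕₚ.m∸[m∸n]≡n bs≤as) (ℕₚ.∸-monoˡ-< as<j e≤as)

record IsDivMod (a b : Poly) (qr : Poly × Poly) : Set where
  field
    quotient-Normal  : Normal (proj₁ qr)
    remainder-Normal : Normal (proj₂ qr)
    division         : coeff a ≋ coeff (proj₁ qr) ⊛ coeff b ⊕ coeff (proj₂ qr)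
    remainder-length : length (proj₂ qr) < length b

divStep-isDivMod : ∀ k a y bs → Normal a → Normal (y ∷ bs) → length a < k →
  IsDivMod a (y ∷ bs) (divStep k a (y ∷ bs))
divStep-isDivMod (suc k) a y bs na nB a<k with length a ℕ.<? length (y ∷ bs)
... | yes a<b = record
  { quotient-Normal = refl ; remainder-Normal = na ; remainder-length = a<b
  ; division = mk≋ λ i → sym (trans (cong (_+ coeff a i) (⊛-zeroˡ (coeff (y ∷ bs)) i))
                                    (ℚₚ.+-identityˡ (coeff a i))) }
divStep-isDivMod (suc k) [] y bs na nB a<k | no a≮b = ⊥-elim (a≮b (s≤s z≤n))
divStep-isDivMod (suc k) (x ∷ as) y bs na nB a<k | no a≮b
  with divStep k (reduce (x ∷ as) (y ∷ bs)) (y ∷ bs)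
     | divStep-isDivMod k (reduce (x ∷ as) (y ∷ bs)) y bs (reduce-Normal (x ∷ as) (y ∷ bs)) nB
         (ℕₚ.≤-<-trans (reduce-length x as y bs nB (ℕₚ.≤-pred (ℕₚ.≮⇒≥ a≮b))) (ℕₚ.≤-pred a<k))
... | q , r | ih = record
  { quotient-Normal = addP-Normal m q
  ; remainder-Normal = IsDivMod.remainder-Normal ih
  ; remainder-length = IsDivMod.remainder-length ih
  ; division = begin
      coeff A
    ≈⟨ solve 2 (λ a mb → a := (a :- mb) :+ mb) Ser.refl (coeff A) (coeff m ⊛ coeff B) ⟩
      coeff A ⊕ ⊝ (coeff m ⊛ coeff B) ⊕ coeff m ⊛ coeff B
    ≈⟨ Ser.+-congʳ (Ser.sym (mk≋ (coeff-subP-mulP A m B))) ⟩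
      coeff (reduce A B) ⊕ coeff m ⊛ coeff B
    ≈⟨ Ser.+-congʳ (IsDivMod.division ih) ⟩
      coeff q ⊛ coeff B ⊕ coeff r ⊕ coeff m ⊛ coeff B
    ≈⟨ solve 4 (λ q b r m → q :* b :+ r :+ m :* b := (m :+ q) :* b :+ r)
               Ser.refl (coeff q) (coeff B) (coeff r) (coeff m) ⟩
      (coeff m ⊕ coeff q) ⊛ coeff B ⊕ coeff r
    ≈⟨ Ser.+-congʳ (Ser.*-congʳ (Ser.sym (mk≋ (coeff-addP m q)))) ⟩
      coeff (addP m q) ⊛ coeff B ⊕ coeff r ∎ }
  where
  open SetoidReasoning Ser.setoid
  A = x ∷ as
  B = y ∷ bs
  m = leadMonomial A B

divModP-isDivMod : ∀ a y bs → Normal a → Normal (y ∷ bs) →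
  IsDivMod a (y ∷ bs) (divModP a (y ∷ bs))
divModP-isDivMod a y bs na nB = divStep-isDivMod (suc (length a)) a y bs na nB ℕₚ.≤-refl

divMod-unique : ∀ {A B : Series} {q r q′ r′ n} → Normal q → Normal q′ → Normal r → Normal r′ →
  HasDeg B n → DegLt (coeff r) n → DegLt (coeff r′) n →
  A ≋ coeff q ⊛ B ⊕ coeff r → A ≋ coeff q′ ⊛ B ⊕ coeff r′ → q ≡ q′ × r ≡ r′
divMod-unique {A} {B} {q} {r} {q′} {r′} {n} nq nq′ nr nr′ B∼n r<n r′<n A≋ A≋′ = q≡q′ , r≡r′
  where
  open SetoidReasoning Ser.setoid
  Q = coeff q
  Q′ = coeff q′
  R = coeff r
  R′ = coeff r′
  [Q-Q′]B≋R′-R : (Q ⊕ ⊝ Q′) ⊛ B ≋ R′ ⊕ ⊝ R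
  [Q-Q′]B≋R′-R = begin
      (Q ⊕ ⊝ Q′) ⊛ B
    ≈⟨ solve 5 (λ q q′ b r r′ → (q :- q′) :* b := ((q :* b :+ r) :- (q′ :* b :+ r′)) :+ (r′ :- r))
               Ser.refl Q Q′ B R R′ ⟩
      (Q ⊛ B ⊕ R ⊕ ⊝ (Q′ ⊛ B ⊕ R′)) ⊕ (R′ ⊕ ⊝ R)
    ≈⟨ Ser.+-congʳ (Ser.+-cong (Ser.sym A≋) (Ser.-‿cong (Ser.sym A≋′))) ⟩
      (A ⊕ ⊝ A) ⊕ (R′ ⊕ ⊝ R)
    ≈⟨ solve 3 (λ a r r′ → (a :- a) :+ (r′ :- r) := r′ :- r) Ser.refl A R R′ ⟩
      R′ ⊕ ⊝ R ∎
  q≡q′ : q ≡ q′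
  q≡q′ with subP q q′ | subP-Normal q q′ | coeff-subP q q′
  ... | [] | _ | Q-Q′≐0 = coeff-injective nq nq′ (λ i → x∙y⁻¹≈ε⇒x≈y (Q i) (Q′ i) (sym (Q-Q′≐0 i)))
  ... | c ∷ d | nd | Q-Q′≐ =
    ⊥-elim (proj₁ R′-R∼ (DegLt-⊕ r′<n (DegLt-⊝ r<n) (length d ℕ.+ n) (ℕₚ.m≤n+m n (length d))))
    where
    R′-R∼ : HasDeg (R′ ⊕ ⊝ R) (length d ℕ.+ n)
    R′-R∼ = HasDeg-cong (λ i → trans (⊛-cong Q-Q′≐ (λ _ → refl) i) (coeffwise [Q-Q′]B≋R′-R i))
                         (HasDeg-⊛ (HasDeg-cons c d nd) B∼n)
  r≡r′ : r ≡ r′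
  r≡r′ = coeff-injective nr nr′ (coeffwise (begin
      R
    ≈⟨ solve 3 (λ q b r → r := q :* b :+ r :- q :* b) Ser.refl Q B R ⟩
      Q ⊛ B ⊕ R ⊕ ⊝ (Q ⊛ B)
    ≈⟨ Ser.+-congʳ (Ser.trans (Ser.sym A≋) (subst (λ t → A ≋ coeff t ⊛ B ⊕ R′) (sym q≡q′) A≋′)) ⟩
      Q ⊛ B ⊕ R′ ⊕ ⊝ (Q ⊛ B)
    ≈⟨ solve 3 (λ q b r → q :* b :+ r :- q :* b := r) Ser.refl Q B R′ ⟩
      R′ ∎))

quotient-degree : ∀ {ρ y σs q τ} → Normal ρ → Normal (y ∷ σs) → IsDivMod ρ (y ∷ σs) (q , τ) →
  (q ≡ [] × ρ ≡ τ) ⊎ (deg q ℕ.+ length σs ≡ deg ρ)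
quotient-degree {ρ} {y} {σs} {[]} {τ} nρ nσ ρ÷σ =
  inj₁ (refl , coeff-injective nρ (IsDivMod.remainder-Normal ρ÷σ) λ i →
    trans (coeffwise (IsDivMod.division ρ÷σ) i)
          (trans (cong (_+ coeff τ i) (⊛-zeroˡ (coeff (y ∷ σs)) i)) (ℚₚ.+-identityˡ _)))
quotient-degree {ρ} {y} {σs} {c ∷ qs} {τ} nρ nσ ρ÷σ = inj₂ (sym (proj₂ (HasDeg⇒deg ρ nρ ρ∼)))
  where
  ρ∼ : HasDeg (coeff ρ) (length qs ℕ.+ length σs)
  ρ∼ = HasDeg-cong (λ i → sym (coeffwise (IsDivMod.division ρ÷σ) i)) (HasDeg-⊕-DegLt
         (HasDeg-⊛ (HasDeg-cons c qs (IsDivMod.quotient-Normal ρ÷σ)) (HasDeg-cons y σs nσ))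
         (DegLt-mono (ℕₚ.m≤n+m (length σs) (length qs))
                     (DegLt-mono (ℕₚ.≤-pred (IsDivMod.remainder-length ρ÷σ)) (DegLt-length τ))))

remainder-deg≤ : ∀ {ρ y σs q τ} → Normal ρ → Normal (y ∷ σs) → IsDivMod ρ (y ∷ σs) (q , τ) →
  deg τ ≤ deg ρ
remainder-deg≤ {ρ} {y} {σs} {q} {τ} nρ nσ ρ÷σ with quotient-degree nρ nσ ρ÷σ
... | inj₁ (_ , ρ≡τ) = ℕₚ.≤-reflexive (cong deg (sym ρ≡τ))
... | inj₂ q+σ≡ρ = begin
  deg τ                    ≤⟨ ℕₚ.m∸n≤m (length τ) 1 ⟩
  length τ                 ≤⟨ ℕₚ.≤-pred (IsDivMod.remainder-length ρ÷σ) ⟩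
  length σs                ≤⟨ ℕₚ.m≤n+m (length σs) (deg q) ⟩
  deg q ℕ.+ length σs      ≡⟨ q+σ≡ρ ⟩
  deg ρ                    ∎
  where open ℕₚ.≤-Reasoning

quotient-⊛-DegLt : ∀ {ρ y σs q τ} → Normal ρ → Normal (y ∷ σs) → IsDivMod ρ (y ∷ σs) (q , τ) →
  ∀ ν {K} → deg ν ℕ.+ deg ρ ≤ K → DegLt (coeff q ⊛ coeff ν) (suc (K ∸ length σs))
quotient-⊛-DegLt nρ nσ ρ÷σ ν ν+ρ≤K with quotient-degree nρ nσ ρ÷σ
quotient-⊛-DegLt nρ nσ ρ÷σ ν ν+ρ≤K | inj₁ (refl , _) = λ j _ → ⊛-zeroˡ (coeff ν) j
quotient-⊛-DegLt {ρ} {σs = σs} {q} nρ nσ ρ÷σ ν {K} ν+ρ≤K | inj₂ q+σ≡ρ =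
  DegLt-mono (s≤s (ℕₚ.m+n≤o⇒m≤o∸n (deg q ℕ.+ deg ν) (subst (_≤ K) reassoc ν+ρ≤K)))
             (DegLt-⊛ (suc (deg q)) (DegLt-deg q) (DegLt-deg ν))
  where
  open ≡-Reasoning
  reassoc : deg ν ℕ.+ deg ρ ≡ deg q ℕ.+ deg ν ℕ.+ length σs
  reassoc = begin
    deg ν ℕ.+ deg ρ                    ≡⟨ cong (deg ν ℕ.+_) q+σ≡ρ ⟨
    deg ν ℕ.+ (deg q ℕ.+ length σs)    ≡⟨ ℕₚ.+-assoc (deg ν) (deg q) (length σs) ⟨
    deg ν ℕ.+ deg q ℕ.+ length σs      ≡⟨ cong (ℕ._+ length σs) (ℕₚ.+-comm (deg ν) (deg q)) ⟩
    deg q ℕ.+ deg ν ℕ.+ length σs      ∎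

-- Euclid's algorithm on pairs dominated by a polynomial of large degree

lift-division : ∀ {P Q ρ σ q τ μ ν F A : Series} →
  P ≋ ρ ⊛ F ⊕ μ ⊛ A → Q ≋ σ ⊛ F ⊕ ν ⊛ A → ρ ≋ q ⊛ σ ⊕ τ →
  P ≋ q ⊛ Q ⊕ (τ ⊛ F ⊕ (μ ⊕ ⊝ (q ⊛ ν)) ⊛ A)
lift-division {P} {Q} {ρ} {σ} {q} {τ} {μ} {ν} {F} {A} P≋ Q≋ ρ≋ = begin
    P
  ≈⟨ P≋ ⟩
    ρ ⊛ F ⊕ μ ⊛ A
  ≈⟨ Ser.+-congʳ (Ser.*-congʳ ρ≋) ⟩
    (q ⊛ σ ⊕ τ) ⊛ F ⊕ μ ⊛ A
  ≈⟨ solve 7 (λ q σ τ F ν μ A → (q :* σ :+ τ) :* F :+ μ :* A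
                               := q :* (σ :* F :+ ν :* A) :+ (τ :* F :+ (μ :- q :* ν) :* A))
             Ser.refl q σ τ F ν μ A ⟩
    q ⊛ (σ ⊛ F ⊕ ν ⊛ A) ⊕ (τ ⊛ F ⊕ (μ ⊕ ⊝ (q ⊛ ν)) ⊛ A)
  ≈⟨ Ser.+-congʳ (Ser.*-congˡ (Ser.sym Q≋)) ⟩
    q ⊛ Q ⊕ (τ ⊛ F ⊕ (μ ⊕ ⊝ (q ⊛ ν)) ⊛ A) ∎
  where open SetoidReasoning Ser.setoid

cfStep-suc : ∀ k a c b →
  cfStep (suc k) a (c ∷ b) ≡ proj₁ (divModP a (c ∷ b)) ∷ cfStep k (c ∷ b) (proj₂ (divModP a (c ∷ b)))
cfStep-suc k a c b with divModP a (c ∷ b)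
... | q , r = refl

module Lifting (a g : Poly) (D E : ℕ) (g∼E : HasDeg (coeff g) E)
               (a<D : DegLt (coeff a) (suc D)) (2D<E : suc (D ℕ.+ D) ≤ E) where

  DegLt-⊛a : ∀ {h} K n → K ≤ D → DegLt h (suc K) → DegLt (h ⊛ coeff a) (n ℕ.+ E)
  DegLt-⊛a K n K≤D h<K = DegLt-mono K+D<n+E (DegLt-⊛ (suc K) h<K a<D)
    where
    K+D<n+E : suc K ℕ.+ D ≤ n ℕ.+ E
    K+D<n+E = ℕₚ.≤-trans (s≤s (ℕₚ.+-monoˡ-≤ D K≤D)) (ℕₚ.≤-trans 2D<E (ℕₚ.m≤n+m E n))

  lift-HasDeg : ∀ {σ Q ν k} → HasDeg (coeff σ) k →
    coeff Q ≋ coeff σ ⊛ coeff g ⊕ coeff ν ⊛ coeff a → deg ν ≤ D → HasDeg (coeff Q) (k ℕ.+ E)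
  lift-HasDeg {ν = ν} {k} σ∼k Q≋ ν≤D = HasDeg-cong (λ i → sym (coeffwise Q≋ i))
    (HasDeg-⊕-DegLt (HasDeg-⊛ σ∼k g∼E) (DegLt-⊛a (deg ν) k ν≤D (DegLt-deg ν)))

  record Lifts (ρ σ P Q : Poly) : Set where
    field
      μ ν      : Poly
      ρ-Normal : Normal ρ
      σ-Normal : Normal σ
      P-Normal : Normal P
      Q-Normal : Normal Q
      P≋       : coeff P ≋ coeff ρ ⊛ coeff g ⊕ coeff μ ⊛ coeff a
      Q≋       : coeff Q ≋ coeff σ ⊛ coeff g ⊕ coeff ν ⊛ coeff a
      deg-νρ   : deg ν ℕ.+ deg ρ ≤ D
      deg-μσ   : deg μ ℕ.+ deg σ ≤ D

  lift-length : ∀ {σ Q ν} → Normal σ → Normal Q →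
    coeff Q ≋ coeff σ ⊛ coeff g ⊕ coeff ν ⊛ coeff a → deg ν ≤ D → length σ ≤ length Q
  lift-length {[]} _ _ _ _ = z≤n
  lift-length {y ∷ σs} {[]} {ν} nσ nQ Q≋ ν≤D =
    ⊥-elim (proj₁ (lift-HasDeg {y ∷ σs} {[]} {ν} (HasDeg-cons y σs nσ) Q≋ ν≤D) refl)
  lift-length {y ∷ σs} {w ∷ ws} {ν} nσ nQ Q≋ ν≤D =
    s≤s (subst (length σs ≤_) (sym ws≡σs+E) (ℕₚ.m≤m+n (length σs) E))
    where
    ws≡σs+E : length ws ≡ length σs ℕ.+ E
    ws≡σs+E = proj₂ (HasDeg⇒deg (w ∷ ws) nQ
                (lift-HasDeg {y ∷ σs} {w ∷ ws} {ν} (HasDeg-cons y σs nσ) Q≋ ν≤D))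

  Lifts-length : ∀ {ρ σ P Q} → Lifts ρ σ P Q → length ρ ℕ.+ length σ ≤ length P ℕ.+ length Q
  Lifts-length {ρ} {σ} L = ℕₚ.+-mono-≤
    (lift-length {ρ} {_} {μ} ρ-Normal P-Normal P≋ (ℕₚ.≤-trans (ℕₚ.m≤m+n (deg μ) (deg σ)) deg-μσ))
    (lift-length {σ} {_} {ν} σ-Normal Q-Normal Q≋ (ℕₚ.≤-trans (ℕₚ.m≤m+n (deg ν) (deg ρ)) deg-νρ))
    where open Lifts L

  Lifts-HasDeg : ∀ {ρ y σs P Q} → Lifts ρ (y ∷ σs) P Q → HasDeg (coeff Q) (length σs ℕ.+ E)
  Lifts-HasDeg {ρ} {y} {σs} {Q = Q} L = lift-HasDeg {y ∷ σs} {Q} {ν}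
    (HasDeg-cons y σs σ-Normal) Q≋ (ℕₚ.≤-trans (ℕₚ.m≤m+n (deg ν) (deg ρ)) deg-νρ)
    where open Lifts L

  lift : Poly → Poly → Poly
  lift ρ μ = addP (mulP ρ g) (mulP μ a)

  coeff-lift : ∀ ρ μ → coeff (lift ρ μ) ≐ coeff ρ ⊛ coeff g ⊕ coeff μ ⊛ coeff a
  coeff-lift ρ μ i =
    trans (coeff-addP (mulP ρ g) (mulP μ a) i) (cong₂ _+_ (coeff-mulP ρ g i) (coeff-mulP μ a i))

  lift-DegLt : ∀ τ ν {n} → length τ ≤ n → DegLt (coeff ν) (suc (D ∸ n)) →
    DegLt (coeff (lift τ ν)) (n ℕ.+ E)
  lift-DegLt τ ν {n} τ≤n ν<D∸n = DegLt-cong (λ i → sym (coeff-lift τ ν i))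
    (DegLt-⊕ (DegLt-mono (ℕₚ.+-monoˡ-≤ E τ≤n) (DegLt-⊛ (length τ) (DegLt-length τ) (proj₂ g∼E)))
             (DegLt-⊛a (D ∸ n) n (ℕₚ.m∸n≤m D n) ν<D∸n))

  lift-step : ∀ {ρ y σs P z Qs} → Lifts ρ (y ∷ σs) P (z ∷ Qs) →
    proj₁ (divModP P (z ∷ Qs)) ≡ proj₁ (divModP ρ (y ∷ σs)) ×
    Lifts (y ∷ σs) (proj₂ (divModP ρ (y ∷ σs))) (z ∷ Qs) (proj₂ (divModP P (z ∷ Qs)))
  lift-step {ρ} {y} {σs} {P} {z} {Qs} L
    with divModP ρ (y ∷ σs) | divModP-isDivMod ρ y σs (Lifts.ρ-Normal L) (Lifts.σ-Normal L)
       | divModP P (z ∷ Qs) | divModP-isDivMod P z Qs (Lifts.P-Normal L) (Lifts.Q-Normal L)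
  ... | q , τ | ρ÷σ | q′ , r′ | P÷Q = proj₁ unique , record
    { μ = ν ; ν = ν′
    ; ρ-Normal = σ-Normal ; σ-Normal = IsDivMod.remainder-Normal ρ÷σ
    ; P-Normal = Q-Normal ; Q-Normal = IsDivMod.remainder-Normal P÷Q
    ; P≋ = Q≋ ; Q≋ = mk≋ λ i → trans (cong (λ t → coeff t i) (proj₂ unique)) (coeff-lift τ ν′ i)
    ; deg-νρ = deg-ν′σ
    ; deg-μσ = ℕₚ.≤-trans (ℕₚ.+-monoʳ-≤ (deg ν) (remainder-deg≤ ρ-Normal σ-Normal ρ÷σ)) deg-νρ }
    where
    open Lifts L
    n = length σs
    ν′ = subP μ (mulP q ν)
    ν′<D∸n : DegLt (coeff ν′) (suc (D ∸ n))
    ν′<D∸n = DegLt-cong (λ i → sym (coeff-subP-mulP μ q ν i))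
      (DegLt-⊕ (DegLt-mono (s≤s (ℕₚ.m+n≤o⇒m≤o∸n (deg μ) deg-μσ)) (DegLt-deg μ))
               (DegLt-⊝ (quotient-⊛-DegLt ρ-Normal σ-Normal ρ÷σ ν deg-νρ)))
    deg-ν′σ : deg ν′ ℕ.+ n ≤ D
    deg-ν′σ = ℕₚ.≤-trans (ℕₚ.+-monoˡ-≤ n (deg-least ν′ (subP-Normal μ (mulP q ν)) ν′<D∸n))
                         (ℕₚ.≤-reflexive (ℕₚ.m∸n+n≡m (ℕₚ.≤-trans (ℕₚ.m≤n+m n (deg μ)) deg-μσ)))
    P≋qQ+R : coeff P ≋ coeff q ⊛ coeff (z ∷ Qs) ⊕ coeff (lift τ ν′)
    P≋qQ+R = Ser.trans (lift-division P≋ Q≋ (IsDivMod.division ρ÷σ))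
                       (Ser.+-congˡ {coeff q ⊛ coeff (z ∷ Qs)} R≋)
      where
      R≋ : coeff τ ⊛ coeff g ⊕ (coeff μ ⊕ ⊝ (coeff q ⊛ coeff ν)) ⊛ coeff a ≋ coeff (lift τ ν′)
      R≋ = mk≋ λ i → sym (trans (coeff-lift τ ν′ i) (cong ((coeff τ ⊛ coeff g) i +_)
                                (⊛-cong (coeff-subP-mulP μ q ν) (λ _ → refl) i)))
    Q∼ : HasDeg (coeff (z ∷ Qs)) (n ℕ.+ E)
    Q∼ = Lifts-HasDeg L
    r′<Q : DegLt (coeff r′) (n ℕ.+ E)
    r′<Q = DegLt-mono (subst (length r′ ≤_) (proj₂ (HasDeg⇒deg (z ∷ Qs) Q-Normal Q∼))
                             (ℕₚ.≤-pred (IsDivMod.remainder-length P÷Q)))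
                      (DegLt-length r′)
    unique : q′ ≡ q × r′ ≡ lift τ ν′
    unique = divMod-unique (IsDivMod.quotient-Normal P÷Q) (IsDivMod.quotient-Normal ρ÷σ)
      (IsDivMod.remainder-Normal P÷Q) (addP-Normal (mulP τ g) (mulP ν′ a)) Q∼ r′<Q
      (lift-DegLt τ ν′ (ℕₚ.≤-pred (IsDivMod.remainder-length ρ÷σ)) ν′<D∸n)
      (IsDivMod.division P÷Q) P≋qQ+R

  lift-cfStep : ∀ k k′ {ρ σ P Q} → k ≤ k′ → Lifts ρ σ P Q →
    ∃ λ bs → cfStep k′ P Q ≡ cfStep k ρ σ ++ bs
  lift-cfStep zero k′ {P = P} {Q} _ _ = cfStep k′ P Q , refl
  lift-cfStep (suc k) k′ {σ = []} {P} {Q} _ _ = cfStep k′ P Q , refl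
  lift-cfStep (suc k) (suc k′) {σ = y ∷ σs} {Q = []} _ L = ⊥-elim (proj₁ (Lifts-HasDeg L) refl)
  lift-cfStep (suc k) (suc k′) {ρ} {y ∷ σs} {P} {z ∷ Qs} (s≤s k≤k′) L =
    let q′≡q , L′ = lift-step L
        bs , rest≡ = lift-cfStep k k′ k≤k′ L′
    in bs , (begin
      cfStep (suc k′) P (z ∷ Qs)
    ≡⟨ cfStep-suc k′ P z Qs ⟩
      proj₁ (divModP P (z ∷ Qs)) ∷ cfStep k′ (z ∷ Qs) (proj₂ (divModP P (z ∷ Qs)))
    ≡⟨ cong₂ _∷_ q′≡q rest≡ ⟩
      proj₁ (divModP ρ (y ∷ σs)) ∷ (cfStep k (y ∷ σs) (proj₂ (divModP ρ (y ∷ σs))) ++ bs)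
    ≡⟨ cong (_++ bs) (cfStep-suc k ρ y σs) ⟨
      cfStep (suc k) ρ (y ∷ σs) ++ bs ∎)
    where open ≡-Reasoning

  lift-cf : ∀ {ρ σ P Q} → Lifts ρ σ P Q → ∃ λ bs → cf P Q ≡ cf ρ σ ++ bs
  lift-cf {ρ} {σ} {P} {Q} L =
    lift-cfStep (suc (length ρ ℕ.+ length σ)) (suc (length P ℕ.+ length Q)) (s≤s (Lifts-length L)) L

-- Iterates and the products Π_n

coeff-compP : ∀ c p g → coeff (compP (c ∷ p) g) ≐ constₛ c ⊕ coeff g ⊛ coeff (compP p g)
coeff-compP c p g i =
  trans (coeff-addP (constP c) (mulP g (compP p g)) i)
        (cong₂ _+_ (coeff-constP c i) (coeff-mulP g (compP p g) i))

HasDeg-compP : ∀ c p g {e} → Normal (c ∷ p) → HasDeg (coeff g) e → 1 ≤ e →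
  HasDeg (coeff (compP (c ∷ p) g)) (length p ℕ.* e)
HasDeg-compP c [] g np g∼e _ = HasDeg-cong (λ i → sym (coeff-compP c [] g i))
  (HasDeg-⊕-DegLt (HasDeg-cong singleton (HasDeg-cons c [] np))
                  (λ j _ → trans (⊛-comm (coeff g) 0ₛ j) (⊛-zeroˡ (coeff g) j)))
  where
  singleton : coeff (c ∷ []) ≐ constₛ c
  singleton zero = refl
  singleton (suc i) = refl
HasDeg-compP c (d ∷ p) g {e} np g∼e 1≤e = HasDeg-cong const-last
  (HasDeg-⊕-DegLt (HasDeg-⊛ g∼e (HasDeg-compP d p g (Normal-tail c d p np) g∼e 1≤e))
                  (DegLt-mono (ℕₚ.≤-trans 1≤e (ℕₚ.m≤m+n e (length p ℕ.* e))) (DegLt-constₛ c)))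
  where
  const-last : coeff g ⊛ coeff (compP (d ∷ p) g) ⊕ constₛ c ≐ coeff (compP (c ∷ d ∷ p) g)
  const-last i = trans (ℚₚ.+-comm _ (constₛ c i)) (sym (coeff-compP c (d ∷ p) g i))

iter-HasDeg : ∀ F → Normal F → 1 ≤ deg F → ∀ i → HasDeg (coeff (iter F i)) (deg F ^ i)
iter-HasDeg F nF 1≤d zero = (λ ()) , DegLt-length X
iter-HasDeg (c ∷ p) nF 1≤d (suc i) =
  HasDeg-compP c p (iter (c ∷ p) i) nF (iter-HasDeg (c ∷ p) nF 1≤d i)
    (ℕₚ.m^n>0 (length p) {{ℕ.>-nonZero 1≤d}} i)

geomSum : ℕ → ℕ → ℕ
geomSum d zero = 1
geomSum d (suc n) = geomSum d n ℕ.+ d ^ suc n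

1+2geomSum≤pow : ∀ {d} → 3 ≤ d → ∀ n → suc (geomSum d n ℕ.+ geomSum d n) ≤ d ^ suc n
1+2geomSum≤pow {d} 3≤d zero = subst (3 ≤_) (sym (ℕₚ.*-identityʳ d)) 3≤d
1+2geomSum≤pow {d} 3≤d (suc n) = begin
    suc (s ℕ.+ x ℕ.+ (s ℕ.+ x))   ≡⟨ regroup s x ⟩
    suc (s ℕ.+ s) ℕ.+ (x ℕ.+ x)   ≤⟨ ℕₚ.+-monoˡ-≤ (x ℕ.+ x) (1+2geomSum≤pow 3≤d n) ⟩
    x ℕ.+ (x ℕ.+ x)               ≡⟨ triple x ⟩
    3 ℕ.* x                       ≤⟨ ℕₚ.*-monoˡ-≤ x 3≤d ⟩
    d ℕ.* x                       ∎
  where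
  open ℕₚ.≤-Reasoning
  s = geomSum d n
  x = d ^ suc n
  regroup : ∀ s x → suc (s ℕ.+ x ℕ.+ (s ℕ.+ x)) ≡ suc (s ℕ.+ s) ℕ.+ (x ℕ.+ x)
  regroup = ℕ-Solver.solve-∀
  triple : ∀ x → x ℕ.+ (x ℕ.+ x) ≡ 3 ℕ.* x
  triple = ℕ-Solver.solve-∀

numΠ-Normal : ∀ F n → Normal (numΠ F n)
numΠ-Normal F zero = addP-Normal X oneP
numΠ-Normal F (suc n) = mulP-Normal (numΠ F n) (addP (iter F (suc n)) oneP)

denΠ-Normal : ∀ F n → Normal (denΠ F n)
denΠ-Normal F zero = refl
denΠ-Normal F (suc n) = mulP-Normal (denΠ F n) (iter F (suc n))

module _ (F : Poly) (nF : Normal F) (1≤d : 1 ≤ deg F) where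

  iter+1-DegLt : ∀ i → DegLt (coeff (addP (iter F i) oneP)) (suc (deg F ^ i))
  iter+1-DegLt i = DegLt-cong (λ j → sym (coeff-addP (iter F i) oneP j))
    (DegLt-⊕ (proj₂ (iter-HasDeg F nF 1≤d i)) (DegLt-mono (s≤s z≤n) (DegLt-length oneP)))

  numΠ-DegLt : ∀ n → DegLt (coeff (numΠ F n)) (suc (geomSum (deg F) n))
  numΠ-DegLt zero = iter+1-DegLt 0
  numΠ-DegLt (suc n) = DegLt-cong (λ j → sym (coeff-mulP (numΠ F n) (addP (iter F (suc n)) oneP) j))
    (DegLt-⊛ (suc (geomSum (deg F) n)) (numΠ-DegLt n) (iter+1-DegLt (suc n)))

  denΠ-DegLt : ∀ n → DegLt (coeff (denΠ F n)) (suc (geomSum (deg F) n))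
  denΠ-DegLt zero = DegLt-length X
  denΠ-DegLt (suc n) = DegLt-cong (λ j → sym (coeff-mulP (denΠ F n) (iter F (suc n)) j))
    (DegLt-⊛ (suc (geomSum (deg F) n)) (denΠ-DegLt n) (proj₂ (iter-HasDeg F nF 1≤d (suc n))))

cf-Π-prefix : ∀ F → Normal F → 3 ≤ deg F → ∀ n →
  ∃ λ bs → cf (numΠ F (suc n)) (denΠ F (suc n)) ≡ cf (numΠ F n) (denΠ F n) ++ bs
cf-Π-prefix F nF 3≤d n = lift-cf Π-Lifts
  where
  1≤d : 1 ≤ deg F
  1≤d = ℕₚ.≤-trans (s≤s z≤n) 3≤d
  a = numΠ F n
  b = denΠ F n
  g = iter F (suc n)
  open Lifting a g (geomSum (deg F) n) (deg F ^ suc n)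
    (iter-HasDeg F nF 1≤d (suc n)) (numΠ-DegLt F nF 1≤d n) (1+2geomSum≤pow 3≤d n)
  Π-Lifts : Lifts a b (numΠ F (suc n)) (denΠ F (suc n))
  Π-Lifts = record
    { μ = oneP ; ν = []
    ; ρ-Normal = numΠ-Normal F n ; σ-Normal = denΠ-Normal F n
    ; P-Normal = numΠ-Normal F (suc n) ; Q-Normal = denΠ-Normal F (suc n)
    ; P≋ = begin
        coeff (mulP a (addP g oneP))       ≈⟨ mk≋ (coeff-mulP a (addP g oneP)) ⟩
        coeff a ⊛ coeff (addP g oneP)      ≈⟨ Ser.*-congˡ (mk≋ (coeff-addP g oneP)) ⟩
        coeff a ⊛ (coeff g ⊕ coeff oneP)   ≈⟨ solve 3 (λ a g o → a :* (g :+ o) := a :* g :+ o :* a)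
                                                       Ser.refl (coeff a) (coeff g) (coeff oneP) ⟩
        coeff a ⊛ coeff g ⊕ coeff oneP ⊛ coeff a ∎
    ; Q≋ = mk≋ λ i → trans (coeff-mulP b g i)
             (sym (trans (cong ((coeff b ⊛ coeff g) i +_) (⊛-zeroˡ (coeff a) i)) (ℚₚ.+-identityʳ _)))
    ; deg-νρ = deg-least a (numΠ-Normal F n) (numΠ-DegLt F nF 1≤d n)
    ; deg-μσ = deg-least b (denΠ-Normal F n) (denΠ-DegLt F nF 1≤d n)
    }
    where open SetoidReasoning Ser.setoid

lemma2p3 : (f : List ℤ) → 3 ≤ deg (ofℤ f) →
    (n : ℕ) (as : List Poly) → S f n ≡ oneP ∷ as →
    ∃ λ (bs : List Poly) → S f (suc n) ≡ oneP ∷ (as ++ bs)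
lemma2p3 f 3≤d n as Sn≡1∷as =
  let bs , Sn+1≡Sn++bs = cf-Π-prefix (ofℤ f) (norm-Normal (map (ℚ._/ 1) f)) 3≤d n
  in bs , trans Sn+1≡Sn++bs (cong (_++ bs) Sn≡1∷as)
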